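{- Let $(\mathcal{S},\mathcal{E})$ be a set cover instance with maximal set size $s$ in which every element lies in at most $t$ sets, and run the base algorithm (described in the context). Let $e\in\mathcal{E}$ be arbitrary and let $X_e$ be the random variable which equals $0$ if $e$ does not get covered during the first stage ($i=1$), and otherwise equals the number of sets containing $e$ that are added to $\mathcal{S}_{\mathrm{cvr}}$ in the same iteration in which $e$ is covered for the first time. Then $\mathbb{E}[X_e]\le 5$.
   Context: A set cover instance consists of a universe $\mathcal{E}$ and a family $\mathcal{S}$ of subsets of $\mathcal{E}$ whose union is $\mathcal{E}$. All logarithms are base $2$, and $\log s$, $\log t$ are treated as integers. The base algorithm: start with $\mathcal{S}_{\mathrm{cvr}}=\emptyset$. For stage $i=1,\dots,\log s$, and within each stage for iteration $k=1,\dots,\log t$: for every set $S\in\mathcal{S}$ simultaneously, let $d(S)$ be the number of elements of $S$ not covered by $\mathcal{S}_{\mathrm{cvr}}$ at the beginning of the iteration; if $d(S)\ge s/2^i$, add $S$ to $\mathcal{S}_{\mathrm{cvr}}$ independently with probability $2^k/t$. Finally return $\mathcal{S}_{\mathrm{cvr}}$. An element is covered once some set containing it is in $\mathcal{S}_{\mathrm{cvr}}$. -}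

module Defs where

open import Data.Nat as ℕ using (ℕ; zero; suc; _^_; _≤?_)
open import Data.Nat.Logarithm using (⌊log₂_⌋)
open import Data.Integer using (+_)
open import Data.Rational using (ℚ; 0ℚ; 1ℚ; _/_; _*_; _+_; _-_)
open import Data.Bool using (Bool; true; false; _∧_; _∨_; if_then_else_)
open import Data.Fin using (Fin)
open import Data.Fin.Subset using (Subset; ∣_∣; _∩_; _∪_; ∁)
open import Data.Vec using (Vec; []; _∷_; lookup; tabulate; replicate)
open import Data.List using (List; []; _∷_; map; concatMap; foldr; _++_)
open import Data.Product using (_×_; _,_)
open import Relation.Nullary.Decidable using (⌊_⌋)

-- Finite discrete probability: a distribution is a finite list of
-- (probability weight, outcome) pairs with rational weights.

Dist : Set → Set
Dist A = List (ℚ × A)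

return : {A : Set} → A → Dist A
return a = (1ℚ , a) ∷ []

bind : {A B : Set} → Dist A → (A → Dist B) → Dist B
bind d f = concatMap (λ { (p , a) → map (λ { (q , b) → (p * q , b) }) (f a) }) d

coin : ℚ → Dist Bool
coin p = (p , true) ∷ (1ℚ - p , false) ∷ []

flips : {m : ℕ} → Vec ℚ m → Dist (Vec Bool m)
flips [] = return []
flips (p ∷ ps) = bind (coin p) λ b → bind (flips ps) λ bs → return (b ∷ bs)

expect : {A : Set} → Dist A → (A → ℕ) → ℚ
expect d X = foldr (λ { (p , a) acc → p * ((+ X a) / 1) + acc }) 0ℚ d

-- Set cover instances: universe ℰ = Fin n, family 𝒮 indexed by Fin m.

Family : ℕ → ℕ → Set
Family m n = Fin m → Subset n

anyFin : {m : ℕ} → (Fin m → Bool) → Bool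
anyFin {zero} f = false
anyFin {suc m} f = f Fin.zero ∨ anyFin (λ j → f (Fin.suc j))

_∈ᵇ_ : {n : ℕ} → Fin n → Subset n → Bool
e ∈ᵇ S = lookup S e

coveredBy : {m n : ℕ} → Family m n → Subset m → Subset n
coveredBy F C = tabulate λ e → anyFin λ j → (j ∈ᵇ C) ∧ (e ∈ᵇ F j)

containing : {m n : ℕ} → Family m n → Fin n → Subset m
containing F e = tabulate λ j → e ∈ᵇ F j

degree : {m n : ℕ} → Family m n → Subset m → Fin m → ℕ
degree F C j = ∣ F j ∩ ∁ (coveredBy F C) ∣

IsSetCover : {m n : ℕ} → Family m n → Set
IsSetCover {m} {n} F = (e : Fin n) → Data.Product.Σ (Fin m) λ j → e Data.Fin.Subset.∈ F j

MaxSetSize : {m n : ℕ} → Family m n → ℕ → Set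
MaxSetSize {m} F s = ((j : Fin m) → ∣ F j ∣ ℕ.≤ s) × Data.Product.Σ (Fin m) λ j → ∣ F j ∣ Relation.Binary.PropositionalEquality.≡ s
  where import Relation.Binary.PropositionalEquality

MaxFrequency : {m n : ℕ} → Family m n → ℕ → Set
MaxFrequency {m} {n} F t = (e : Fin n) → ∣ containing F e ∣ ℕ.≤ t

-- probability 2^k / t  (t = 0 cannot occur for a nonempty instance)
prob : ℕ → ℕ → ℚ
prob k zero = 0ℚ
prob k (suc t) = (+ (2 ^ k)) / suc t

-- eligibility in stage i: d(S) ≥ s / 2^i, i.e. s ≤ 2^i · d(S)
eligible : {m n : ℕ} → Family m n → ℕ → ℕ → Subset m → Fin m → Bool
eligible F s i C j = ⌊ s ≤? (2 ^ i) ℕ.* degree F C j ⌋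

-- one trace entry: (stage i, iteration k, sets added in this iteration)
Entry : ℕ → Set
Entry m = ℕ × ℕ × Subset m

iteration : {m n : ℕ} → Family m n → (s t i k : ℕ) → Subset m → Dist (Subset m)
iteration F s t i k C = flips (tabulate λ j → if eligible F s i C j then prob k t else 0ℚ)

-- iterations k = k₀, …, k₀ + r - 1 of stage i; state = (𝒮cvr, trace)
iterationsFrom : {m n : ℕ} → Family m n → (s t i k₀ r : ℕ) →
                 Subset m × List (Entry m) → Dist (Subset m × List (Entry m))
iterationsFrom F s t i k₀ zero st = return st
iterationsFrom F s t i k₀ (suc r) (C , tr) =
  bind (iteration F s t i k₀ C) λ A →
  iterationsFrom F s t i (suc k₀) r (C ∪ A , tr ++ ((i , k₀ , A) ∷ []))

stagesFrom : {m n : ℕ} → Family m n → (s t i₀ r : ℕ) →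
             Subset m × List (Entry m) → Dist (Subset m × List (Entry m))
stagesFrom F s t i₀ zero st = return st
stagesFrom F s t i₀ (suc r) st =
  bind (iterationsFrom F s t i₀ 1 ⌊log₂ t ⌋ st) λ st' →
  stagesFrom F s t (suc i₀) r st'

baseAlgorithm : {m n : ℕ} → Family m n → (s t : ℕ) → Dist (Subset m × List (Entry m))
baseAlgorithm {m} F s t = stagesFrom F s t 1 ⌊log₂ s ⌋ (replicate m false , [])

Xtrace : {m n : ℕ} → Family m n → Fin n → List (Entry m) → ℕ
Xtrace F e [] = 0
Xtrace F e ((i , k , A) ∷ tr) with ∣ A ∩ containing F e ∣
... | zero = Xtrace F e tr
... | suc c = if ⌊ i ℕ.≟ 1 ⌋ then suc c else 0

X : {m n : ℕ} → Family m n → Fin n → Subset m × List (Entry m) → ℕ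
X F e (C , tr) = Xtrace F e tr

module Submission where

open import Defs
open import Data.Nat using (ℕ)
open import Data.Fin using (Fin)
open import Data.Integer using (+_)
open import Data.Rational using (_≤_; _/_)

-- The expected value of X_e is bounded by a potential argument over the
-- iterations of the first stage.  Let K be the sets containing e and let
-- q_k(C, j) = 2^k/t be the probability with which set j is picked in
-- iteration k of stage 1 when the current cover is C (0 if j is not
-- eligible).  While e is still uncovered, the remaining expected value of
-- X_e from iteration k on is at most the budget  2 + Σ_{j∈K} q_k(C, j).
-- One iteration contributes the expected number of hits Σ_{j∈K} q_k and,
-- with probability Π_{j∈K} (1 - q_k), leaves e uncovered; then the next
-- budget is at most 2 + 2 Σ_{j∈K} q_k, because probabilities double and
-- eligibility only shrinks as C grows.  The generalised Bernoulli
-- inequality Π (1 - q_j) · (1 + Σ q_j) ≤ 1 closes the induction.  At the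
-- start the budget is 2 + |K| · 2/t ≤ 4 ≤ 5, and later stages never change
-- X_e.

open import Data.Nat as ℕ using (zero; suc; z≤n; s≤s; ⌊_/2⌋)
import Data.Nat.Properties as ℕₚ
open import Data.Nat.Logarithm using (⌊log₂_⌋; ⌊log₂⌊n/2⌋⌋≡⌊log₂n⌋∸1)
import Data.Integer as ℤ
import Data.Integer.Properties as ℤₚ
open import Data.Rational using (ℚ; 0ℚ; 1ℚ; _+_; _*_; _-_; -_; toℚᵘ; nonNegative)
open import Data.Rational.Properties
import Data.Rational.Unnormalised as ℚᵘ
import Data.Rational.Unnormalised.Properties as ℚᵘₚ
open import Data.Rational.Solver using (module +-*-Solver)
open import Data.Bool using (Bool; true; false; if_then_else_; _∧_)
open import Data.Fin.Subset using (Subset; ∣_∣; _∩_; _∪_; _⊆_)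
open import Data.Fin.Subset.Properties using (p⊆q⇒∣p∣≤∣q∣; p⊆q⇒∁p⊇∁q; p⊆p∪q; x∈p∩q⁺; x∈p∩q⁻)
open import Data.Vec using (Vec; []; _∷_; lookup; tabulate; replicate)
open import Data.Vec.Properties using (lookup∘tabulate; []=⇒lookup; lookup⇒[]=)
open import Data.List using (List; []; _∷_; _++_; map)
open import Data.List.Properties using (++-assoc; ++-identityʳ)
open import Data.List.Relation.Unary.All as All using (All; []; _∷_)
open import Data.List.Relation.Unary.All.Properties using (++⁺; map⁺)
open import Data.Product using (_×_; _,_; proj₁; proj₂; Σ)
open import Data.Unit using (tt)
open import Function using (_∘_)
open import Relation.Nullary using (yes; no; contradiction)
open import Relation.Binary.PropositionalEquality

ι : ℕ → ℚ
ι n = + n / 1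

-- a fraction a/(d+1) is, as an unnormalised rational, literally a/(d+1);
-- this is how all the arithmetic facts below are transferred to ℚ
frac-toℚᵘ : ∀ a d → toℚᵘ (+ a / suc d) ℚᵘ.≃ ℚᵘ.mkℚᵘ (+ a) d
frac-toℚᵘ a d = toℚᵘ-fromℚᵘ (ℚᵘ.mkℚᵘ (+ a) d)

frac-≤ : ∀ a b c d → a ℕ.* suc d ℕ.≤ c ℕ.* suc b → + a / suc b ≤ + c / suc d
frac-≤ a b c d cross = toℚᵘ-cancel-≤ (begin
    toℚᵘ (+ a / suc b)  ≃⟨ frac-toℚᵘ a b ⟩
    ℚᵘ.mkℚᵘ (+ a) b     ≤⟨ ℚᵘ.*≤* (subst₂ ℤ._≤_ (ℤₚ.pos-* a (suc d)) (ℤₚ.pos-* c (suc b)) (ℤ.+≤+ cross)) ⟩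
    ℚᵘ.mkℚᵘ (+ c) d     ≃⟨ ℚᵘₚ.≃-sym (frac-toℚᵘ c d) ⟩
    toℚᵘ (+ c / suc d)  ∎)
  where open ℚᵘₚ.≤-Reasoning

ι-+ : ∀ a b → ι a + ι b ≡ ι (a ℕ.+ b)
ι-+ a b = toℚᵘ-injective (begin
    toℚᵘ (ι a + ι b)                         ≈⟨ toℚᵘ-homo-+ (ι a) (ι b) ⟩
    toℚᵘ (ι a) ℚᵘ.+ toℚᵘ (ι b)               ≈⟨ ℚᵘₚ.+-cong (frac-toℚᵘ a 0) (frac-toℚᵘ b 0) ⟩
    ℚᵘ.mkℚᵘ (+ a) 0 ℚᵘ.+ ℚᵘ.mkℚᵘ (+ b) 0     ≈⟨ ℚᵘ.*≡* (cong (ℤ._* + 1) numerator) ⟩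
    ℚᵘ.mkℚᵘ (+ (a ℕ.+ b)) 0                  ≈⟨ ℚᵘₚ.≃-sym (frac-toℚᵘ (a ℕ.+ b) 0) ⟩
    toℚᵘ (ι (a ℕ.+ b))                       ∎)
  where
  open ℚᵘₚ.≃-Reasoning
  numerator : + a ℤ.* + 1 ℤ.+ + b ℤ.* + 1 ≡ + (a ℕ.+ b)
  numerator = trans (cong₂ ℤ._+_ (ℤₚ.*-identityʳ (+ a)) (ℤₚ.*-identityʳ (+ b))) (sym (ℤₚ.pos-+ a b))

ι-*-frac : ∀ a b d → ι a * (+ b / suc d) ≡ + (a ℕ.* b) / suc d
ι-*-frac a b d = toℚᵘ-injective (begin
    toℚᵘ (ι a * (+ b / suc d))                 ≈⟨ toℚᵘ-homo-* (ι a) (+ b / suc d) ⟩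
    toℚᵘ (ι a) ℚᵘ.* toℚᵘ (+ b / suc d)         ≈⟨ ℚᵘₚ.*-cong (frac-toℚᵘ a 0) (frac-toℚᵘ b d) ⟩
    ℚᵘ.mkℚᵘ (+ a) 0 ℚᵘ.* ℚᵘ.mkℚᵘ (+ b) d       ≈⟨ ℚᵘ.*≡* cross ⟩
    ℚᵘ.mkℚᵘ (+ (a ℕ.* b)) d                    ≈⟨ ℚᵘₚ.≃-sym (frac-toℚᵘ (a ℕ.* b) d) ⟩
    toℚᵘ (+ (a ℕ.* b) / suc d)                 ∎)
  where
  open ℚᵘₚ.≃-Reasoning
  cross : (+ a ℤ.* + b) ℤ.* + suc d ≡ + (a ℕ.* b) ℤ.* + suc (d ℕ.+ 0)
  cross = cong₂ ℤ._*_ (sym (ℤₚ.pos-* a b)) (cong (λ x → + suc x) (sym (ℕₚ.+-identityʳ d)))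

ι-suc : ∀ n → ι (suc n) ≡ 1ℚ + ι n
ι-suc n = sym (ι-+ 1 n)

ι-mono : ∀ {a b} → a ℕ.≤ b → ι a ≤ ι b
ι-mono {a} {b} a≤b = frac-≤ a 0 b 0 (ℕₚ.*-monoˡ-≤ 1 a≤b)

ι-nonneg : ∀ a → 0ℚ ≤ ι a
ι-nonneg a = ι-mono {0} {a} z≤n

twice-half≤ : ∀ n → 2 ℕ.* ⌊ n /2⌋ ℕ.≤ n
twice-half≤ n = begin
    2 ℕ.* ⌊ n /2⌋           ≡⟨ cong (⌊ n /2⌋ ℕ.+_) (ℕₚ.+-identityʳ ⌊ n /2⌋) ⟩
    ⌊ n /2⌋ ℕ.+ ⌊ n /2⌋     ≤⟨ ℕₚ.+-monoʳ-≤ ⌊ n /2⌋ (ℕₚ.⌊n/2⌋≤⌈n/2⌉ n) ⟩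
    ⌊ n /2⌋ ℕ.+ ℕ.⌈ n /2⌉   ≡⟨ ℕₚ.⌊n/2⌋+⌈n/2⌉≡n n ⟩
    n                       ∎
  where open ℕₚ.≤-Reasoning

pow2≤ : ∀ k n → k ℕ.≤ ⌊log₂ suc n ⌋ → 2 ℕ.^ k ℕ.≤ suc n
pow2≤ zero n _ = s≤s z≤n
pow2≤ (suc k) (suc n) k<log = begin
    2 ℕ.* 2 ℕ.^ k             ≤⟨ ℕₚ.*-monoʳ-≤ 2 (pow2≤ k ⌊ n /2⌋ k≤log-half) ⟩
    2 ℕ.* suc ⌊ n /2⌋         ≡⟨ ℕₚ.*-suc 2 ⌊ n /2⌋ ⟩
    2 ℕ.+ 2 ℕ.* ⌊ n /2⌋       ≤⟨ ℕₚ.+-monoʳ-≤ 2 (twice-half≤ n) ⟩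
    suc (suc n)               ∎
  where
  open ℕₚ.≤-Reasoning
  k≤log-half : k ℕ.≤ ⌊log₂ suc ⌊ n /2⌋ ⌋
  k≤log-half = subst (k ℕ.≤_) (sym (⌊log₂⌊n/2⌋⌋≡⌊log₂n⌋∸1 (suc (suc n)))) (ℕₚ.∸-monoˡ-≤ 1 k<log)

InUnit : ℚ → Set
InUnit q = 0ℚ ≤ q × q ≤ 1ℚ

prob-nonneg : ∀ k t → 0ℚ ≤ prob k t
prob-nonneg k zero    = ≤-refl
prob-nonneg k (suc d) = frac-≤ 0 0 (2 ℕ.^ k) d z≤n

prob-unit : ∀ k t → k ℕ.≤ ⌊log₂ t ⌋ → InUnit (prob k t)
prob-unit k zero    _     = ≤-refl , ι-nonneg 1
prob-unit k (suc d) k≤log = prob-nonneg k (suc d) , frac-≤ (2 ℕ.^ k) d 1 0 cross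
  where
  cross : 2 ℕ.^ k ℕ.* 1 ℕ.≤ 1 ℕ.* suc d
  cross = subst₂ ℕ._≤_ (sym (ℕₚ.*-identityʳ _)) (sym (ℕₚ.*-identityˡ _)) (pow2≤ k d k≤log)

prob-double : ∀ k t → prob (suc k) t ≡ ι 2 * prob k t
prob-double k zero    = refl
prob-double k (suc d) = sym (ι-*-frac 2 (2 ℕ.^ k) d)

prob-first : ∀ a t → a ℕ.≤ t → ι a * prob 1 t ≤ ι 2
prob-first a zero    _   = subst (_≤ ι 2) (sym (*-zeroʳ (ι a))) (ι-nonneg 2)
prob-first a (suc d) a≤t = subst (_≤ ι 2) (sym (ι-*-frac a 2 d)) (frac-≤ (a ℕ.* 2) d 2 0 cross)
  where
  cross : a ℕ.* 2 ℕ.* 1 ℕ.≤ 2 ℕ.* suc d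
  cross = subst (ℕ._≤ 2 ℕ.* suc d) (trans (ℕₚ.*-comm 2 a) (sym (ℕₚ.*-identityʳ _))) (ℕₚ.*-monoʳ-≤ 2 a≤t)

𝔼 : {A : Set} → Dist A → (A → ℚ) → ℚ
𝔼 []            g = 0ℚ
𝔼 ((p , a) ∷ d) g = p * g a + 𝔼 d g

mass : {A : Set} → Dist A → ℚ
mass d = 𝔼 d (λ _ → 1ℚ)

Always : {A : Set} → (A → Set) → Dist A → Set
Always P d = All (P ∘ proj₂) d

NonNegWeights : {A : Set} → Dist A → Set
NonNegWeights d = All (λ x → 0ℚ ≤ proj₁ x) d

expect≡𝔼 : {A : Set} (d : Dist A) (X : A → ℕ) → expect d X ≡ 𝔼 d (ι ∘ X)
expect≡𝔼 []            X = refl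
expect≡𝔼 ((p , a) ∷ d) X = cong (_+_ (p * ι (X a))) (expect≡𝔼 d X)

𝔼-++ : {A : Set} (xs ys : Dist A) (g : A → ℚ) → 𝔼 (xs ++ ys) g ≡ 𝔼 xs g + 𝔼 ys g
𝔼-++ []            ys g = sym (+-identityˡ _)
𝔼-++ ((p , a) ∷ xs) ys g =
  trans (cong (_+_ (p * g a)) (𝔼-++ xs ys g)) (sym (+-assoc (p * g a) (𝔼 xs g) (𝔼 ys g)))

𝔼-scale : {A : Set} (p : ℚ) (h : ℚ × A → ℚ × A) → (∀ q b → h (q , b) ≡ (p * q , b)) →
          (l : Dist A) (g : A → ℚ) → 𝔼 (map h l) g ≡ p * 𝔼 l g
𝔼-scale p h h≡ []            g = sym (*-zeroʳ p)
𝔼-scale p h h≡ ((q , b) ∷ l) g rewrite h≡ q b = begin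
    p * q * g b + 𝔼 (map h l) g  ≡⟨ cong₂ _+_ (*-assoc p q (g b)) (𝔼-scale p h h≡ l g) ⟩
    p * (q * g b) + p * 𝔼 l g    ≡⟨ sym (*-distribˡ-+ p _ _) ⟩
    p * (q * g b + 𝔼 l g)        ∎
  where open ≡-Reasoning

𝔼-bind : {A B : Set} (d : Dist A) (f : A → Dist B) (g : B → ℚ) →
         𝔼 (bind d f) g ≡ 𝔼 d (λ a → 𝔼 (f a) g)
𝔼-bind []            f g = refl
𝔼-bind ((p , a) ∷ d) f g =
  trans (𝔼-++ (map _ (f a)) (bind d f) g) (cong₂ _+_ (𝔼-scale p _ (λ _ _ → refl) (f a) g) (𝔼-bind d f g))

𝔼-return : {A : Set} (a : A) (g : A → ℚ) → 𝔼 (return a) g ≡ g a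
𝔼-return a g = trans (+-identityʳ _) (*-identityˡ _)

𝔼-cong : {A : Set} (d : Dist A) {g h : A → ℚ} → (∀ a → g a ≡ h a) → 𝔼 d g ≡ 𝔼 d h
𝔼-cong []            g≡h = refl
𝔼-cong ((p , a) ∷ d) g≡h = cong₂ (λ x y → p * x + y) (g≡h a) (𝔼-cong d g≡h)

𝔼-+ : {A : Set} (d : Dist A) (g h : A → ℚ) → 𝔼 d (λ a → g a + h a) ≡ 𝔼 d g + 𝔼 d h
𝔼-+ []            g h = refl
𝔼-+ ((p , a) ∷ d) g h rewrite 𝔼-+ d g h =
  solve 5 (λ p x y u v → p :* (x :+ y) :+ (u :+ v) := (p :* x :+ u) :+ (p :* y :+ v))
    refl p (g a) (h a) (𝔼 d g) (𝔼 d h)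
  where open +-*-Solver

𝔼-*ʳ : {A : Set} (d : Dist A) (g : A → ℚ) (c : ℚ) → 𝔼 d (λ a → g a * c) ≡ 𝔼 d g * c
𝔼-*ʳ []            g c = sym (*-zeroˡ c)
𝔼-*ʳ ((p , a) ∷ d) g c rewrite 𝔼-*ʳ d g c =
  solve 4 (λ p x c u → p :* (x :* c) :+ u :* c := (p :* x :+ u) :* c) refl p (g a) c (𝔼 d g)
  where open +-*-Solver

𝔼-zero : {A : Set} (d : Dist A) → 𝔼 d (λ _ → 0ℚ) ≡ 0ℚ
𝔼-zero []            = refl
𝔼-zero ((p , a) ∷ d) = trans (cong₂ _+_ (*-zeroʳ p) (𝔼-zero d)) (+-identityˡ 0ℚ)

𝔼-const-on : {A : Set} (d : Dist A) {g : A → ℚ} {c : ℚ} →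
             Always (λ a → g a ≡ c) d → 𝔼 d g ≡ mass d * c
𝔼-const-on []            {c = c} []     = sym (*-zeroˡ c)
𝔼-const-on ((p , a) ∷ d) {c = c} (ga≡c ∷ rest) rewrite ga≡c | 𝔼-const-on d rest =
  solve 3 (λ p c m → p :* c :+ m :* c := (p :* con 1ℚ :+ m) :* c) refl p c (mass d)
  where open +-*-Solver

𝔼-constant : {A : Set} (d : Dist A) {g : A → ℚ} {c : ℚ} →
             mass d ≡ 1ℚ → Always (λ a → g a ≡ c) d → 𝔼 d g ≡ c
𝔼-constant d {c = c} mass≡1 g≡c = trans (𝔼-const-on d g≡c) (trans (cong (_* c) mass≡1) (*-identityˡ c))

𝔼-mono : {A : Set} (d : Dist A) {g h : A → ℚ} → NonNegWeights d → (∀ a → g a ≤ h a) → 𝔼 d g ≤ 𝔼 d h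
𝔼-mono []            []           g≤h = ≤-refl
𝔼-mono ((p , a) ∷ d) (p≥0 ∷ rest) g≤h =
  +-mono-≤ (*-monoˡ-≤-nonNeg p {{nonNegative p≥0}} (g≤h a)) (𝔼-mono d rest g≤h)

*-nonneg : {p q : ℚ} → 0ℚ ≤ p → 0ℚ ≤ q → 0ℚ ≤ p * q
*-nonneg {p} {q} p≥0 q≥0 =
  nonNegative⁻¹ (p * q) {{nonNeg*nonNeg⇒nonNeg p {{nonNegative p≥0}} q {{nonNegative q≥0}}}}

NonNeg-bind : {A B : Set} (d : Dist A) (f : A → Dist B) →
              NonNegWeights d → (∀ a → NonNegWeights (f a)) → NonNegWeights (bind d f)
NonNeg-bind []            f []           nf = []
NonNeg-bind ((p , a) ∷ d) f (p≥0 ∷ rest) nf =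
  ++⁺ (map⁺ (All.map (*-nonneg p≥0) (nf a))) (NonNeg-bind d f rest nf)

Always-bind : {A B : Set} (d : Dist A) (f : A → Dist B) {Q : A → Set} {P : B → Set} →
              Always Q d → (∀ a → Q a → Always P (f a)) → Always P (bind d f)
Always-bind []            f []         pf = []
Always-bind ((p , a) ∷ d) f (qa ∷ rest) pf =
  ++⁺ (map⁺ (pf a qa)) (Always-bind d f rest pf)

mass-bind : {A B : Set} (d : Dist A) (f : A → Dist B) → (∀ a → mass (f a) ≡ 1ℚ) → mass (bind d f) ≡ mass d
mass-bind d f mass≡1 = trans (𝔼-bind d f (λ _ → 1ℚ)) (𝔼-cong d mass≡1)

𝔼-flips-∷ : {m : ℕ} (q : ℚ) (qs : Vec ℚ m) (G : Vec Bool (suc m) → ℚ) →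
            𝔼 (flips (q ∷ qs)) G ≡ q * 𝔼 (flips qs) (G ∘ (true ∷_)) + (1ℚ - q) * 𝔼 (flips qs) (G ∘ (false ∷_))
𝔼-flips-∷ q qs G =
  trans (𝔼-bind (coin q) (λ b → bind (flips qs) λ bs → return (b ∷ bs)) G)
    (cong₂ (λ x y → q * x + y) (tail-𝔼 true) (trans (+-identityʳ _) (cong ((1ℚ - q) *_) (tail-𝔼 false))))
  where
  tail-𝔼 : ∀ b → 𝔼 (bind (flips qs) λ bs → return (b ∷ bs)) G ≡ 𝔼 (flips qs) (G ∘ (b ∷_))
  tail-𝔼 b = trans (𝔼-bind (flips qs) (λ bs → return (b ∷ bs)) G) (𝔼-cong (flips qs) (λ bs → 𝔼-return (b ∷ bs) G))

mass-flips : {m : ℕ} (qs : Vec ℚ m) → mass (flips qs) ≡ 1ℚ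
mass-flips []       = 𝔼-return {Vec Bool 0} [] (λ _ → 1ℚ)
mass-flips (q ∷ qs) = begin
    mass (flips (q ∷ qs))                       ≡⟨ 𝔼-flips-∷ q qs (λ _ → 1ℚ) ⟩
    q * mass (flips qs) + (1ℚ - q) * mass (flips qs)  ≡⟨ cong (λ x → q * x + (1ℚ - q) * x) (mass-flips qs) ⟩
    q * 1ℚ + (1ℚ - q) * 1ℚ                      ≡⟨ solve 1 (λ q → q :* con 1ℚ :+ (con 1ℚ :- q) :* con 1ℚ := con 1ℚ) refl q ⟩
    1ℚ                                          ∎
  where
  open ≡-Reasoning
  open +-*-Solver

1-q-nonneg : {q : ℚ} → q ≤ 1ℚ → 0ℚ ≤ 1ℚ - q
1-q-nonneg {q} q≤1 = subst₂ _≤_ (+-inverseʳ q) refl (+-monoˡ-≤ (- q) q≤1)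

NonNeg-flips : {m : ℕ} (q : Fin m → ℚ) → (∀ j → InUnit (q j)) → NonNegWeights (flips (tabulate q))
NonNeg-flips {zero}  q unit = ι-nonneg 1 ∷ []
NonNeg-flips {suc m} q unit =
  NonNeg-bind (coin (q Fin.zero)) (λ b → bind tail (λ bs → return (b ∷ bs))) (q0≥0 ∷ 1-q-nonneg q0≤1 ∷ [])
    (λ b → NonNeg-bind tail (λ bs → return (b ∷ bs)) (NonNeg-flips (q ∘ Fin.suc) (unit ∘ Fin.suc)) (λ _ → ι-nonneg 1 ∷ []))
  where
  tail = flips (tabulate (q ∘ Fin.suc))
  q0≥0 = proj₁ (unit Fin.zero)
  q0≤1 = proj₂ (unit Fin.zero)

hitMean : {m : ℕ} → (Fin m → ℚ) → Subset m → ℚ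
hitMean q []          = 0ℚ
hitMean q (true ∷ K)  = q Fin.zero + hitMean (q ∘ Fin.suc) K
hitMean q (false ∷ K) = hitMean (q ∘ Fin.suc) K

missProb : {m : ℕ} → (Fin m → ℚ) → Subset m → ℚ
missProb q []          = 1ℚ
missProb q (true ∷ K)  = (1ℚ - q Fin.zero) * missProb (q ∘ Fin.suc) K
missProb q (false ∷ K) = missProb (q ∘ Fin.suc) K

isZero : ℕ → ℚ
isZero zero    = 1ℚ
isZero (suc _) = 0ℚ

average-same : (q x : ℚ) → q * x + (1ℚ - q) * x ≡ x
average-same = solve 2 (λ q x → q :* x :+ (con 1ℚ :- q) :* x := x) refl
  where open +-*-Solver

expected-hits : {m : ℕ} (q : Fin m → ℚ) (K : Subset m) →
                𝔼 (flips (tabulate q)) (λ A → ι ∣ A ∩ K ∣) ≡ hitMean q K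
expected-hits q []          = 𝔼-return {Vec Bool 0} [] (λ A → ι ∣ A ∩ [] ∣)
expected-hits q (true ∷ K)  = begin
    𝔼 (flips (tabulate q)) (λ A → ι ∣ A ∩ (true ∷ K) ∣)
      ≡⟨ 𝔼-flips-∷ q₀ (tabulate (q ∘ Fin.suc)) (λ A → ι ∣ A ∩ (true ∷ K) ∣) ⟩
    q₀ * 𝔼 rest (λ A → ι (suc ∣ A ∩ K ∣)) + (1ℚ - q₀) * 𝔼 rest (λ A → ι ∣ A ∩ K ∣)
      ≡⟨ cong₂ (λ x y → q₀ * x + (1ℚ - q₀) * y) one-more (expected-hits (q ∘ Fin.suc) K) ⟩
    q₀ * (1ℚ + H) + (1ℚ - q₀) * H
      ≡⟨ solve 2 (λ q h → q :* (con 1ℚ :+ h) :+ (con 1ℚ :- q) :* h := q :+ h) refl q₀ H ⟩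
    q₀ + H ∎
  where
  open ≡-Reasoning
  open +-*-Solver
  q₀ = q Fin.zero
  rest = flips (tabulate (q ∘ Fin.suc))
  H = hitMean (q ∘ Fin.suc) K
  one-more : 𝔼 rest (λ A → ι (suc ∣ A ∩ K ∣)) ≡ 1ℚ + H
  one-more = begin
    𝔼 rest (λ A → ι (suc ∣ A ∩ K ∣))           ≡⟨ 𝔼-cong rest (λ A → ι-suc ∣ A ∩ K ∣) ⟩
    𝔼 rest (λ A → 1ℚ + ι ∣ A ∩ K ∣)            ≡⟨ 𝔼-+ rest (λ _ → 1ℚ) (λ A → ι ∣ A ∩ K ∣) ⟩
    mass rest + 𝔼 rest (λ A → ι ∣ A ∩ K ∣)     ≡⟨ cong₂ _+_ (mass-flips (tabulate (q ∘ Fin.suc))) (expected-hits (q ∘ Fin.suc) K) ⟩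
    1ℚ + H                                     ∎
expected-hits q (false ∷ K) = begin
    𝔼 (flips (tabulate q)) (λ A → ι ∣ A ∩ (false ∷ K) ∣)
      ≡⟨ 𝔼-flips-∷ q₀ (tabulate (q ∘ Fin.suc)) (λ A → ι ∣ A ∩ (false ∷ K) ∣) ⟩
    q₀ * 𝔼 rest (λ A → ι ∣ A ∩ K ∣) + (1ℚ - q₀) * 𝔼 rest (λ A → ι ∣ A ∩ K ∣)
      ≡⟨ average-same q₀ _ ⟩
    𝔼 rest (λ A → ι ∣ A ∩ K ∣)
      ≡⟨ expected-hits (q ∘ Fin.suc) K ⟩
    hitMean (q ∘ Fin.suc) K ∎
  where
  open ≡-Reasoning
  q₀ = q Fin.zero
  rest = flips (tabulate (q ∘ Fin.suc))

miss-probability : {m : ℕ} (q : Fin m → ℚ) (K : Subset m) →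
                   𝔼 (flips (tabulate q)) (λ A → isZero ∣ A ∩ K ∣) ≡ missProb q K
miss-probability q []          = 𝔼-return {Vec Bool 0} [] (λ A → isZero ∣ A ∩ [] ∣)
miss-probability q (true ∷ K)  = begin
    𝔼 (flips (tabulate q)) (λ A → isZero ∣ A ∩ (true ∷ K) ∣)
      ≡⟨ 𝔼-flips-∷ q₀ (tabulate (q ∘ Fin.suc)) (λ A → isZero ∣ A ∩ (true ∷ K) ∣) ⟩
    q₀ * 𝔼 rest (λ _ → 0ℚ) + (1ℚ - q₀) * 𝔼 rest (λ A → isZero ∣ A ∩ K ∣)
      ≡⟨ cong₂ (λ x y → q₀ * x + (1ℚ - q₀) * y) (𝔼-zero rest) (miss-probability (q ∘ Fin.suc) K) ⟩
    q₀ * 0ℚ + (1ℚ - q₀) * missProb (q ∘ Fin.suc) K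
      ≡⟨ trans (cong (_+ (1ℚ - q₀) * missProb (q ∘ Fin.suc) K) (*-zeroʳ q₀)) (+-identityˡ _) ⟩
    (1ℚ - q₀) * missProb (q ∘ Fin.suc) K ∎
  where
  open ≡-Reasoning
  q₀ = q Fin.zero
  rest = flips (tabulate (q ∘ Fin.suc))
miss-probability q (false ∷ K) =
  trans (𝔼-flips-∷ (q Fin.zero) (tabulate (q ∘ Fin.suc)) (λ A → isZero ∣ A ∩ (false ∷ K) ∣))
    (trans (average-same (q Fin.zero) _) (miss-probability (q ∘ Fin.suc) K))

-- one round of coins: pay one for every relevant coin that comes up, or
-- carry b forward if none does
hits-or-carry : {m : ℕ} (q : Fin m → ℚ) (K : Subset m) (b : ℚ) →
                𝔼 (flips (tabulate q)) (λ A → ι (∣ A ∩ K ∣) + isZero (∣ A ∩ K ∣) * b) ≡ hitMean q K + missProb q K * b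
hits-or-carry q K b = begin
    𝔼 coins (λ A → ι (∣ A ∩ K ∣) + isZero (∣ A ∩ K ∣) * b)
      ≡⟨ 𝔼-+ coins (λ A → ι (∣ A ∩ K ∣)) (λ A → isZero (∣ A ∩ K ∣) * b) ⟩
    𝔼 coins (λ A → ι (∣ A ∩ K ∣)) + 𝔼 coins (λ A → isZero (∣ A ∩ K ∣) * b)
      ≡⟨ cong (_+_ (𝔼 coins (λ A → ι (∣ A ∩ K ∣)))) (𝔼-*ʳ coins (λ A → isZero (∣ A ∩ K ∣)) b) ⟩
    𝔼 coins (λ A → ι (∣ A ∩ K ∣)) + 𝔼 coins (λ A → isZero (∣ A ∩ K ∣)) * b
      ≡⟨ cong₂ (λ x y → x + y * b) (expected-hits q K) (miss-probability q K) ⟩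
    hitMean q K + missProb q K * b ∎
  where
  open ≡-Reasoning
  coins = flips (tabulate q)

hitMean-nonneg : {m : ℕ} (q : Fin m → ℚ) → (∀ j → 0ℚ ≤ q j) → ∀ K → 0ℚ ≤ hitMean q K
hitMean-nonneg q q≥0 []          = ≤-refl
hitMean-nonneg q q≥0 (true ∷ K)  = +-mono-≤ (q≥0 Fin.zero) (hitMean-nonneg (q ∘ Fin.suc) (q≥0 ∘ Fin.suc) K)
hitMean-nonneg q q≥0 (false ∷ K) = hitMean-nonneg (q ∘ Fin.suc) (q≥0 ∘ Fin.suc) K

missProb-nonneg : {m : ℕ} (q : Fin m → ℚ) → (∀ j → q j ≤ 1ℚ) → ∀ K → 0ℚ ≤ missProb q K
missProb-nonneg q q≤1 []          = ι-nonneg 1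
missProb-nonneg q q≤1 (true ∷ K)  = *-nonneg (1-q-nonneg (q≤1 Fin.zero)) (missProb-nonneg (q ∘ Fin.suc) (q≤1 ∘ Fin.suc) K)
missProb-nonneg q q≤1 (false ∷ K) = missProb-nonneg (q ∘ Fin.suc) (q≤1 ∘ Fin.suc) K

hitMean-mono : {m : ℕ} (q r : Fin m → ℚ) → (∀ j → q j ≤ r j) → ∀ K → hitMean q K ≤ hitMean r K
hitMean-mono q r q≤r []          = ≤-refl
hitMean-mono q r q≤r (true ∷ K)  = +-mono-≤ (q≤r Fin.zero) (hitMean-mono (q ∘ Fin.suc) (r ∘ Fin.suc) (q≤r ∘ Fin.suc) K)
hitMean-mono q r q≤r (false ∷ K) = hitMean-mono (q ∘ Fin.suc) (r ∘ Fin.suc) (q≤r ∘ Fin.suc) K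

hitMean-scale : {m : ℕ} (c : ℚ) (q r : Fin m → ℚ) → (∀ j → r j ≡ c * q j) → ∀ K → hitMean r K ≡ c * hitMean q K
hitMean-scale c q r r≡cq []          = sym (*-zeroʳ c)
hitMean-scale c q r r≡cq (true ∷ K)  =
  trans (cong₂ _+_ (r≡cq Fin.zero) (hitMean-scale c (q ∘ Fin.suc) (r ∘ Fin.suc) (r≡cq ∘ Fin.suc) K))
        (sym (*-distribˡ-+ c _ _))
hitMean-scale c q r r≡cq (false ∷ K) = hitMean-scale c (q ∘ Fin.suc) (r ∘ Fin.suc) (r≡cq ∘ Fin.suc) K

hitMean-≤ : {m : ℕ} (c : ℚ) (q : Fin m → ℚ) → (∀ j → q j ≤ c) → ∀ K → hitMean q K ≤ ι ∣ K ∣ * c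
hitMean-≤ c q q≤c []          = ≤-reflexive (sym (*-zeroˡ c))
hitMean-≤ c q q≤c (true ∷ K)  = begin
    q Fin.zero + hitMean (q ∘ Fin.suc) K  ≤⟨ +-mono-≤ (q≤c Fin.zero) (hitMean-≤ c (q ∘ Fin.suc) (q≤c ∘ Fin.suc) K) ⟩
    c + ι ∣ K ∣ * c                       ≡⟨ solve 2 (λ c k → c :+ k :* c := (con 1ℚ :+ k) :* c) refl c (ι ∣ K ∣) ⟩
    (1ℚ + ι ∣ K ∣) * c                    ≡⟨ cong (_* c) (sym (ι-suc ∣ K ∣)) ⟩
    ι (suc ∣ K ∣) * c                     ∎
  where
  open ≤-Reasoning
  open +-*-Solver
hitMean-≤ c q q≤c (false ∷ K) = hitMean-≤ c (q ∘ Fin.suc) (q≤c ∘ Fin.suc) K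

miss-hit-≤1 : {m : ℕ} (q : Fin m → ℚ) → (∀ j → InUnit (q j)) → ∀ K → missProb q K * (1ℚ + hitMean q K) ≤ 1ℚ
miss-hit-≤1 q unit []          = ≤-reflexive refl
miss-hit-≤1 q unit (true ∷ K)  = begin
    (1ℚ - q₀) * P * (1ℚ + (q₀ + S))
      ≤⟨ p≤p+q (*-nonneg P≥0 (*-nonneg q₀≥0 (+-mono-≤ q₀≥0 S≥0))) ⟩
    (1ℚ - q₀) * P * (1ℚ + (q₀ + S)) + P * (q₀ * (q₀ + S))
      ≡⟨ solve 3 (λ q p s → (con 1ℚ :- q) :* p :* (con 1ℚ :+ (q :+ s)) :+ p :* (q :* (q :+ s)) := p :* (con 1ℚ :+ s)) refl q₀ P S ⟩
    P * (1ℚ + S)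
      ≤⟨ miss-hit-≤1 (q ∘ Fin.suc) (unit ∘ Fin.suc) K ⟩
    1ℚ ∎
  where
  open ≤-Reasoning
  open +-*-Solver
  q₀ = q Fin.zero
  q₀≥0 = proj₁ (unit Fin.zero)
  P = missProb (q ∘ Fin.suc) K
  S = hitMean (q ∘ Fin.suc) K
  P≥0 = missProb-nonneg (q ∘ Fin.suc) (proj₂ ∘ unit ∘ Fin.suc) K
  S≥0 = hitMean-nonneg (q ∘ Fin.suc) (proj₁ ∘ unit ∘ Fin.suc) K
  p≤p+q : ∀ {x y} → 0ℚ ≤ y → x ≤ x + y
  p≤p+q {x} y≥0 = subst (_≤ x + _) (+-identityʳ x) (+-monoʳ-≤ x y≥0)
miss-hit-≤1 q unit (false ∷ K) = miss-hit-≤1 (q ∘ Fin.suc) (unit ∘ Fin.suc) K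

⊆-lookup : {k : ℕ} {p q : Subset k} → p ⊆ q → ∀ j → lookup p j ≡ true → lookup q j ≡ true
⊆-lookup p⊆q j pj = []=⇒lookup (p⊆q (lookup⇒[]= j _ pj))

anyFin-mono : {k : ℕ} (f g : Fin k → Bool) → (∀ j → f j ≡ true → g j ≡ true) → anyFin f ≡ true → anyFin g ≡ true
anyFin-mono {zero}  f g f⇒g ()
anyFin-mono {suc k} f g f⇒g any-f with f Fin.zero in f₀ | g Fin.zero in g₀
... | _     | true  = refl
... | true  | false = contradiction (trans (sym (f⇒g Fin.zero f₀)) g₀) (λ ())
... | false | false = anyFin-mono (f ∘ Fin.suc) (g ∘ Fin.suc) (f⇒g ∘ Fin.suc) any-f

∧-monoˡ : {b b′ : Bool} (c : Bool) → (b ≡ true → b′ ≡ true) → b ∧ c ≡ true → b′ ∧ c ≡ true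
∧-monoˡ {true} c b⇒b′ b∧c rewrite b⇒b′ refl = b∧c

coveredBy-mono : {m n : ℕ} (F : Family m n) {C C′ : Subset m} → C ⊆ C′ → coveredBy F C ⊆ coveredBy F C′
coveredBy-mono F {C} {C′} C⊆C′ {x} x∈cov = lookup⇒[]= x _ (begin
    lookup (tabulate (covers C′)) x  ≡⟨ lookup∘tabulate (covers C′) x ⟩
    covers C′ x                      ≡⟨ anyFin-mono _ _ (λ j → ∧-monoˡ (x ∈ᵇ F j) (⊆-lookup C⊆C′ j)) covered ⟩
    true                             ∎)
  where
  open ≡-Reasoning
  covers : Subset _ → Fin _ → Bool
  covers D e = anyFin λ j → (j ∈ᵇ D) ∧ (e ∈ᵇ F j)
  covered : covers C x ≡ true
  covered = trans (sym (lookup∘tabulate (covers C) x)) ([]=⇒lookup x∈cov)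

degree-anti : {m n : ℕ} (F : Family m n) {C C′ : Subset m} → C ⊆ C′ → ∀ j → degree F C′ j ℕ.≤ degree F C j
degree-anti F {C} {C′} C⊆C′ j = p⊆q⇒∣p∣≤∣q∣ λ x∈ →
  let (x∈S , x∉cov′) = x∈p∩q⁻ (F j) _ x∈ in
  x∈p∩q⁺ (x∈S , p⊆q⇒∁p⊇∁q (coveredBy-mono F C⊆C′) x∉cov′)

selProb : {m n : ℕ} → Family m n → (s t i k : ℕ) → Subset m → Fin m → ℚ
selProb F s t i k C j = if eligible F s i C j then prob k t else 0ℚ

selProb-unit : {m n : ℕ} (F : Family m n) (s t i k : ℕ) → k ℕ.≤ ⌊log₂ t ⌋ →
               ∀ C j → InUnit (selProb F s t i k C j)
selProb-unit F s t i k k≤log C j with eligible F s i C j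
... | true  = prob-unit k t k≤log
... | false = ≤-refl , ι-nonneg 1

selProb-nonneg : {m n : ℕ} (F : Family m n) (s t i k : ℕ) → ∀ C j → 0ℚ ≤ selProb F s t i k C j
selProb-nonneg F s t i k C j with eligible F s i C j
... | true  = prob-nonneg k t
... | false = ≤-refl

selProb-≤ : {m n : ℕ} (F : Family m n) (s t i k : ℕ) → ∀ C j → selProb F s t i k C j ≤ prob k t
selProb-≤ F s t i k C j with eligible F s i C j
... | true  = ≤-refl
... | false = prob-nonneg k t

selProb-double : {m n : ℕ} (F : Family m n) (s t i k : ℕ) →
                 ∀ C j → selProb F s t i (suc k) C j ≡ ι 2 * selProb F s t i k C j
selProb-double F s t i k C j with eligible F s i C j
... | true  = prob-double k t
... | false = refl

-- sets only lose eligibility as the cover grows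
selProb-anti : {m n : ℕ} (F : Family m n) (s t i k : ℕ) {C C′ : Subset m} → C ⊆ C′ →
               ∀ j → selProb F s t i k C′ j ≤ selProb F s t i k C j
selProb-anti F s t i k {C} {C′} C⊆C′ j
  with s ℕ.≤? 2 ℕ.^ i ℕ.* degree F C′ j | s ℕ.≤? 2 ℕ.^ i ℕ.* degree F C j
... | yes _      | yes _    = ≤-refl
... | yes s≤deg′ | no s≰deg = contradiction (ℕₚ.≤-trans s≤deg′ (ℕₚ.*-monoʳ-≤ (2 ℕ.^ i) (degree-anti F C⊆C′ j))) s≰deg
... | no _       | yes _    = prob-nonneg k t
... | no _       | no _     = ≤-refl

Extends : {m : ℕ} → ℕ → List (Entry m) → Subset m × List (Entry m) → Set
Extends {m} i tr (_ , tr′) = Σ (List (Entry m)) λ rest → tr′ ≡ tr ++ rest × All (λ x → i ℕ.≤ proj₁ x) rest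

iterations-extend : {m n : ℕ} (F : Family m n) (s t i k r : ℕ) (C : Subset m) (tr : List (Entry m)) →
                    Always (Extends i tr) (iterationsFrom F s t i k r (C , tr))
iterations-extend F s t i k zero    C tr = ([] , sym (++-identityʳ tr) , []) ∷ []
iterations-extend F s t i k (suc r) C tr =
  Always-bind (iteration F s t i k C) _ (All.universal (λ _ → tt) _) λ A _ →
    All.map (λ { (rest , tr′≡ , late) → (i , k , A) ∷ rest , trans tr′≡ (++-assoc tr _ rest) , ℕₚ.≤-refl ∷ late })
      (iterations-extend F s t i (suc k) r (C ∪ A) (tr ++ (i , k , A) ∷ []))

stages-extend : {m n : ℕ} (F : Family m n) (s t i r : ℕ) (C : Subset m) (tr : List (Entry m)) →
                Always (Extends i tr) (stagesFrom F s t i r (C , tr))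
stages-extend F s t i zero    C tr = ([] , sym (++-identityʳ tr) , []) ∷ []
stages-extend F s t i (suc r) C tr =
  Always-bind (iterationsFrom F s t i 1 ⌊log₂ t ⌋ (C , tr)) _ (iterations-extend F s t i 1 ⌊log₂ t ⌋ C tr)
    λ { (C′ , tr′) (rest₁ , tr′≡ , late₁) →
      All.map (λ { (rest₂ , tr″≡ , late₂) → rest₁ ++ rest₂
                 , trans tr″≡ (trans (cong (_++ rest₂) tr′≡) (++-assoc tr rest₁ rest₂))
                 , ++⁺ late₁ (All.map (ℕₚ.≤-trans (ℕₚ.n≤1+n i)) late₂) })
        (stages-extend F s t (suc i) r C′ tr′) }

mass-iterations : {m n : ℕ} (F : Family m n) (s t i k r : ℕ) (st : Subset m × List (Entry m)) →
                  mass (iterationsFrom F s t i k r st) ≡ 1ℚ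
mass-iterations F s t i k zero    st       = 𝔼-return st (λ _ → 1ℚ)
mass-iterations F s t i k (suc r) (C , tr) =
  trans (mass-bind (iteration F s t i k C) _ (λ A → mass-iterations F s t i (suc k) r _))
        (mass-flips (tabulate (selProb F s t i k C)))

mass-stages : {m n : ℕ} (F : Family m n) (s t i r : ℕ) (st : Subset m × List (Entry m)) →
              mass (stagesFrom F s t i r st) ≡ 1ℚ
mass-stages F s t i zero    st = 𝔼-return st (λ _ → 1ℚ)
mass-stages F s t i (suc r) st =
  trans (mass-bind (iterationsFrom F s t i 1 ⌊log₂ t ⌋ st) _ (mass-stages F s t (suc i) r))
        (mass-iterations F s t i 1 ⌊log₂ t ⌋ st)

module Traces {m n : ℕ} (F : Family m n) (e : Fin n) where

  K : Subset m
  K = containing F e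

  hits : Subset m → ℕ
  hits A = ∣ A ∩ K ∣

  HitFree : List (Entry m) → Set
  HitFree tr = All (λ x → hits (proj₂ (proj₂ x)) ≡ 0) tr

  Xtrace-skip : (tr rest : List (Entry m)) → HitFree tr → Xtrace F e (tr ++ rest) ≡ Xtrace F e rest
  Xtrace-skip []                  rest []          = refl
  Xtrace-skip ((i , k , A) ∷ tr) rest (no-hit ∷ hf) with ∣ A ∩ K ∣
  ... | zero = Xtrace-skip tr rest hf

  Xtrace-hitfree : (tr : List (Entry m)) → HitFree tr → Xtrace F e tr ≡ 0
  Xtrace-hitfree tr hit-free = trans (cong (Xtrace F e) (sym (++-identityʳ tr))) (Xtrace-skip tr [] hit-free)

  Xtrace-hit : (k : ℕ) (A : Subset m) (c : ℕ) (rest : List (Entry m)) →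
               hits A ≡ suc c → Xtrace F e ((1 , k , A) ∷ rest) ≡ suc c
  Xtrace-hit k A c rest hit with ∣ A ∩ K ∣
  Xtrace-hit k A c rest refl | .(suc c) = refl

  Xtrace-late : (rest : List (Entry m)) → All (λ x → 2 ℕ.≤ proj₁ x) rest → Xtrace F e rest ≡ 0
  Xtrace-late []                  []                       = refl
  Xtrace-late ((i , k , A) ∷ rest) (s≤s (s≤s _) ∷ late) with ∣ A ∩ K ∣
  ... | zero  = Xtrace-late rest late
  ... | suc _ = refl

  Xtrace-ignores-late : (tr rest : List (Entry m)) → All (λ x → 2 ℕ.≤ proj₁ x) rest →
                        Xtrace F e (tr ++ rest) ≡ Xtrace F e tr
  Xtrace-ignores-late []                  rest late = Xtrace-late rest late
  Xtrace-ignores-late ((i , k , A) ∷ tr) rest late with ∣ A ∩ K ∣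
  ... | zero  = Xtrace-ignores-late tr rest late
  ... | suc _ = refl

-- the arithmetic of one iteration: S hits are expected now and, with
-- probability M, e survives into a budget of 2 + 2S
one-iteration : (S M : ℚ) → M * (1ℚ + S) ≤ 1ℚ → S + M * (ι 2 + ι 2 * S) ≤ ι 2 + S
one-iteration S M bernoulli = begin
    S + M * (ι 2 + ι 2 * S)     ≡⟨ solve 3 (λ s m t → s :+ m :* (t :+ t :* s) := s :+ t :* (m :* (con 1ℚ :+ s))) refl S M (ι 2) ⟩
    S + ι 2 * (M * (1ℚ + S))    ≤⟨ +-monoʳ-≤ S (*-monoˡ-≤-nonNeg (ι 2) {{nonNegative (ι-nonneg 2)}} bernoulli) ⟩
    S + ι 2 * 1ℚ                ≡⟨ solve 2 (λ s t → s :+ t :* con 1ℚ := t :+ s) refl S (ι 2) ⟩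
    ι 2 + S                     ∎
  where
  open ≤-Reasoning
  open +-*-Solver

module StageOne {m n : ℕ} (F : Family m n) (s t : ℕ) (e : Fin n) where
  open Traces F e

  Xval : Subset m × List (Entry m) → ℚ
  Xval (_ , tr) = ι (Xtrace F e tr)

  q : ℕ → Subset m → Fin m → ℚ
  q = selProb F s t 1

  -- bound on the expected rest of X_e from iteration k of stage 1 on,
  -- while e is uncovered and the cover is C
  budget : ℕ → Subset m → ℚ
  budget k C = ι 2 + hitMean (q k C) K

  budget-nonneg : ∀ k C → 0ℚ ≤ budget k C
  budget-nonneg k C = +-mono-≤ (ι-nonneg 2) (hitMean-nonneg (q k C) (selProb-nonneg F s t 1 k C) K)

  -- a larger cover makes fewer sets eligible, so the budget shrinks
  budget-anti : ∀ k C A → budget k (C ∪ A) ≤ budget k C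
  budget-anti k C A = +-monoʳ-≤ (ι 2) (hitMean-mono (q k (C ∪ A)) (q k C) (selProb-anti F s t 1 k (p⊆p∪q {p = C} A)) K)

  budget-next : ∀ k C → budget (suc k) C ≡ ι 2 + ι 2 * hitMean (q k C) K
  budget-next k C = cong (_+_ (ι 2)) (hitMean-scale (ι 2) (q k C) (q (suc k) C) (selProb-double F s t 1 k C) K)

  after-hit : ∀ r k C tr A c → HitFree tr → hits A ≡ suc c →
              𝔼 (iterationsFrom F s t 1 (suc k) r (C ∪ A , tr ++ (1 , k , A) ∷ [])) Xval ≡ ι (suc c)
  after-hit r k C tr A c hit-free hit =
    𝔼-constant _ (mass-iterations F s t 1 (suc k) r _)
      (All.map (λ { (rest , tr′≡ , _) → cong ι (trans (cong (Xtrace F e) tr′≡) (hit-then-anything rest)) })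
        (iterations-extend F s t 1 (suc k) r (C ∪ A) (tr ++ (1 , k , A) ∷ [])))
    where
    open ≡-Reasoning
    hit-then-anything : ∀ rest → Xtrace F e ((tr ++ (1 , k , A) ∷ []) ++ rest) ≡ suc c
    hit-then-anything rest = begin
      Xtrace F e ((tr ++ (1 , k , A) ∷ []) ++ rest)  ≡⟨ cong (Xtrace F e) (++-assoc tr _ rest) ⟩
      Xtrace F e (tr ++ (1 , k , A) ∷ rest)          ≡⟨ Xtrace-skip tr _ hit-free ⟩
      Xtrace F e ((1 , k , A) ∷ rest)                ≡⟨ Xtrace-hit k A c rest hit ⟩
      suc c                                          ∎

  stage1-bound : ∀ r k C tr → HitFree tr → k ℕ.+ r ℕ.≤ suc ⌊log₂ t ⌋ →
                 𝔼 (iterationsFrom F s t 1 k r (C , tr)) Xval ≤ budget k C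
  stage1-bound zero k C tr hit-free _ =
    subst (_≤ budget k C) (sym (trans (𝔼-return (C , tr) Xval) (cong ι (Xtrace-hitfree tr hit-free))))
      (budget-nonneg k C)
  stage1-bound (suc r) k C tr hit-free fits = begin
      𝔼 (bind coins next) Xval
        ≡⟨ 𝔼-bind coins next Xval ⟩
      𝔼 coins (λ A → 𝔼 (next A) Xval)
        ≤⟨ 𝔼-mono coins (NonNeg-flips (q k C) (selProb-unit F s t 1 k k≤log C)) continuation ⟩
      𝔼 coins (λ A → ι (hits A) + isZero (hits A) * budget (suc k) C)
        ≡⟨ hits-or-carry (q k C) K (budget (suc k) C) ⟩
      hitMean (q k C) K + missProb (q k C) K * budget (suc k) C
        ≡⟨ cong (λ b → hitMean (q k C) K + missProb (q k C) K * b) (budget-next k C) ⟩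
      hitMean (q k C) K + missProb (q k C) K * (ι 2 + ι 2 * hitMean (q k C) K)
        ≤⟨ one-iteration (hitMean (q k C) K) (missProb (q k C) K) (miss-hit-≤1 (q k C) (selProb-unit F s t 1 k k≤log C) K) ⟩
      budget k C ∎
    where
    open ≤-Reasoning
    coins = flips (tabulate (q k C))
    next : Subset m → Dist (Subset m × List (Entry m))
    next A = iterationsFrom F s t 1 (suc k) r (C ∪ A , tr ++ (1 , k , A) ∷ [])
    fits′ : suc k ℕ.+ r ℕ.≤ suc ⌊log₂ t ⌋
    fits′ = subst (ℕ._≤ suc ⌊log₂ t ⌋) (ℕₚ.+-suc k r) fits
    k≤log : k ℕ.≤ ⌊log₂ t ⌋
    k≤log = ℕₚ.≤-pred (ℕₚ.m+n≤o⇒m≤o (suc k) fits′)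
    continuation : ∀ A → 𝔼 (next A) Xval ≤ ι (hits A) + isZero (hits A) * budget (suc k) C
    continuation A with hits A in count
    ... | zero  = begin
        𝔼 (next A) Xval          ≤⟨ stage1-bound r (suc k) (C ∪ A) _ (++⁺ hit-free (count ∷ [])) fits′ ⟩
        budget (suc k) (C ∪ A)   ≤⟨ budget-anti (suc k) C A ⟩
        budget (suc k) C         ≡⟨ sym (trans (+-identityˡ (1ℚ * budget (suc k) C)) (*-identityˡ (budget (suc k) C))) ⟩
        0ℚ + 1ℚ * budget (suc k) C ∎
    ... | suc c = ≤-reflexive (trans (after-hit r k C tr A c hit-free count)
                                     (sym (trans (cong (_+_ (ι (suc c))) (*-zeroˡ (budget (suc k) C))) (+-identityʳ (ι (suc c))))))

  later-stages : ∀ L st → 𝔼 (stagesFrom F s t 2 L st) Xval ≡ Xval st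
  later-stages L (C , tr) =
    𝔼-constant _ (mass-stages F s t 2 L (C , tr))
      (All.map (λ { (rest , tr′≡ , late) → cong ι (trans (cong (Xtrace F e) tr′≡) (Xtrace-ignores-late tr rest late)) })
        (stages-extend F s t 2 L C tr))

  initial-budget : MaxFrequency F t → budget 1 (replicate m false) ≤ ι 4
  initial-budget max-freq = begin
      ι 2 + hitMean (q 1 ∅) K     ≤⟨ +-monoʳ-≤ (ι 2) (hitMean-≤ (prob 1 t) (q 1 ∅) (selProb-≤ F s t 1 1 ∅) K) ⟩
      ι 2 + ι ∣ K ∣ * prob 1 t    ≤⟨ +-monoʳ-≤ (ι 2) (prob-first ∣ K ∣ t (max-freq e)) ⟩
      ι 2 + ι 2                   ≡⟨ ι-+ 2 2 ⟩
      ι 4                         ∎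
    where
    open ≤-Reasoning
    ∅ = replicate m false

  expected-X : MaxFrequency F t → ∀ L → 𝔼 (stagesFrom F s t 1 L (replicate m false , [])) Xval ≤ ι 5
  expected-X max-freq zero    = ι-nonneg 5
  expected-X max-freq (suc L) = begin
      𝔼 (bind stage1 (stagesFrom F s t 2 L)) Xval        ≡⟨ 𝔼-bind stage1 (stagesFrom F s t 2 L) Xval ⟩
      𝔼 stage1 (λ st → 𝔼 (stagesFrom F s t 2 L st) Xval) ≡⟨ 𝔼-cong stage1 (later-stages L) ⟩
      𝔼 stage1 Xval                                       ≤⟨ stage1-bound ⌊log₂ t ⌋ 1 (replicate m false) [] [] ℕₚ.≤-refl ⟩
      budget 1 (replicate m false)                        ≤⟨ initial-budget max-freq ⟩
      ι 4                                                 ≤⟨ ι-mono (ℕₚ.n≤1+n 4) ⟩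
      ι 5                                                 ∎
    where
    open ≤-Reasoning
    stage1 = iterationsFrom F s t 1 1 ⌊log₂ t ⌋ (replicate m false , [])

lemma3p4 : {m n : ℕ} (F : Family m n) (s t : ℕ) →
           IsSetCover F → MaxSetSize F s → MaxFrequency F t →
           (e : Fin n) →
           expect (baseAlgorithm F s t) (X F e) ≤ (+ 5) / 1
lemma3p4 F s t _ _ max-freq e = begin
    expect (baseAlgorithm F s t) (X F e)     ≡⟨ expect≡𝔼 (baseAlgorithm F s t) (X F e) ⟩
    𝔼 (baseAlgorithm F s t) (ι ∘ X F e)      ≤⟨ StageOne.expected-X F s t e max-freq ⌊log₂ s ⌋ ⟩
    ι 5                                      ∎
  where open ≤-Reasoning
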